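{- For every raw context $\Gamma$ of Glob, the type $\Gamma\vdash_{ps}$ is a proposition (any two derivations of $\Gamma\vdash_{ps}$ are equal), and it is decidable (one can construct an element of $(\Gamma\vdash_{ps})+\neg(\Gamma\vdash_{ps})$).
   Context: Meta-theory: Martin-Löf type theory without axiom K (language of homotopy type theory). Raw syntax of Glob: raw types $*$ and $\Rightarrow(A,t,u)$; raw terms $\mathrm{Var}\,x$, $x\in\mathbb{N}$; raw contexts finite lists of pairs $(x,A)$ ($\mathrm{nil}$ empty, $L::p$ appends $p$, $\ell(L)$ length). The ps-judgement $\Gamma\vdash_{ps}x:A$ (for raw context $\Gamma$, $x\in\mathbb{N}$, raw type $A$) is the inductive family whose inhabitants (derivations) are generated by: (pss) $\mathrm{nil}::(0,*)\vdash_{ps}0:*$; (psd) from $\Gamma\vdash_{ps}f:\Rightarrow(A,\mathrm{Var}\,x,\mathrm{Var}\,y)$ derive $\Gamma\vdash_{ps}y:A$; (pse) from $\Gamma\vdash_{ps}x:A$, with $l=\ell(\Gamma)$, derive $(\Gamma::(l,A))::(l+1,\Rightarrow(A,\mathrm{Var}\,x,\mathrm{Var}\,l))\vdash_{ps}l+1:\Rightarrow(A,\mathrm{Var}\,x,\mathrm{Var}\,l)$. The family $\Gamma\vdash_{ps}$ has the single constructor (ps): for any $x$, from $\Gamma\vdash_{ps}x:*$ derive $\Gamma\vdash_{ps}$. -}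

{-# OPTIONS --without-K #-}
module Defs where

open import Data.Nat using (ℕ; zero; suc; _+_)
open import Data.Product using (_×_; _,_)
open import Relation.Binary.PropositionalEquality using (_≡_)
open import Relation.Nullary using (¬_)
open import Data.Sum using (_⊎_)

mutual
  data Ty : Set where
    ⋆   : Ty
    ⇒  : Ty → Tm → Tm → Ty

  data Tm : Set where
    Var : ℕ → Tm

data Ctx : Set where
  nil  : Ctx
  _::_ : Ctx → ℕ × Ty → Ctx

infixl 5 _::_

ℓ : Ctx → ℕ
ℓ nil = 0
ℓ (Γ :: _) = suc (ℓ Γ)

data _⊢ps_∶_ : Ctx → ℕ → Ty → Set where
  pss : (nil :: (0 , ⋆)) ⊢ps 0 ∶ ⋆
  psd : ∀ {Γ f A x y} → Γ ⊢ps f ∶ ⇒ A (Var x) (Var y) → Γ ⊢ps y ∶ A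
  pse : ∀ {Γ x A} → Γ ⊢ps x ∶ A →
        ((Γ :: (ℓ Γ , A)) :: (suc (ℓ Γ) , ⇒ A (Var x) (Var (ℓ Γ))))
          ⊢ps suc (ℓ Γ) ∶ ⇒ A (Var x) (Var (ℓ Γ))

data _⊢ps : Ctx → Set where
  ps : ∀ {Γ} x → Γ ⊢ps x ∶ ⋆ → Γ ⊢ps

isProp : ∀ {a} → Set a → Set a
isProp P = (p q : P) → p ≡ q

{-# OPTIONS --safe #-}
{-# OPTIONS --without-K #-}
module Submission where

-- Derivations of Γ ⊢ps x ∶ A are rigid: the dimension of A determines x, A and the
-- derivation, since the only freedom is how often psd is applied below the last
-- variable of Γ, and each psd lowers the dimension by one.  Comparing two derivations
-- forces an equation between contexts, which is harmless because raw contexts have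
-- decidable equality and hence form a set (Hedberg).  For decidability, the derivation
-- for the last variable of Γ, if there is one at all, is reconstructed by recursion on
-- Γ; every other derivation is obtained from it by psd, so uniqueness settles the rest.

open import Defs
open import Axiom.UniquenessOfIdentityProofs using (module Decidable⇒UIP)
open import Data.Empty using (⊥-elim)
open import Data.Nat using (ℕ; suc; _≤_; _≤?_)
open import Data.Nat.Properties
  using (≤-refl; ≤-trans; n≤1+n; ≤-pred; ≤∧≢⇒<; <-irrefl; n≮0; suc-injective)
  renaming (_≟_ to _≟ℕ_)
open import Data.Product using (Σ; _×_; _,_; proj₁; proj₂)
open import Data.Product.Properties using (≡-dec; ,-injectiveʳ-UIP)
open import Data.Sum using (_⊎_; inj₁; inj₂)
open import Function using (_∘_; _∋_)
open import Relation.Binary.Definitions using (DecidableEquality)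
open import Relation.Binary.PropositionalEquality using (_≡_; refl; sym; cong; subst)
open import Relation.Nullary using (¬_; Dec; yes; no)
open import Relation.Nullary.Decidable using (map′; _×-dec_)

private
  variable
    Γ Δ : Ctx
    x y t : ℕ
    A B T : Ty

_≟ᵗ_ : DecidableEquality Tm
Var x ≟ᵗ Var y = map′ (cong Var) (λ { refl → refl }) (x ≟ℕ y)

_≟ᵀ_ : DecidableEquality Ty
⋆       ≟ᵀ ⋆         = yes refl
⋆       ≟ᵀ ⇒ _ _ _   = no λ ()
⇒ _ _ _ ≟ᵀ ⋆         = no λ ()
⇒ A t u ≟ᵀ ⇒ B t′ u′ =
  map′ (λ { (refl , refl , refl) → refl }) (λ { refl → refl , refl , refl })
       (A ≟ᵀ B ×-dec t ≟ᵗ t′ ×-dec u ≟ᵗ u′)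

_≟ᶜ_ : DecidableEquality Ctx
nil      ≟ᶜ nil      = yes refl
nil      ≟ᶜ (_ :: _) = no λ ()
(_ :: _) ≟ᶜ nil      = no λ ()
(Γ :: p) ≟ᶜ (Δ :: q) =
  map′ (λ { (refl , refl) → refl }) (λ { refl → refl , refl })
       (Γ ≟ᶜ Δ ×-dec ≡-dec _≟ℕ_ _≟ᵀ_ p q)

dim : Ty → ℕ
dim ⋆         = 0
dim (⇒ A _ _) = suc (dim A)

init : Ctx → Ctx
init nil      = nil
init (Γ :: _) = Γ

lastVar : Ctx → ℕ
lastVar nil            = 0
lastVar (_ :: (x , _)) = x

lastTy : Ctx → Ty
lastTy nil            = ⋆
lastTy (_ :: (_ , A)) = A

extend : Ctx → ℕ → Ty → Ctx
extend Γ x A = Γ :: (ℓ Γ , A) :: (suc (ℓ Γ) , ⇒ A (Var x) (Var (ℓ Γ)))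

Judgement : Ctx → Set
Judgement Γ = Σ ℕ λ x → Σ Ty λ A → Γ ⊢ps x ∶ A

LastJudgement : Ctx → Set
LastJudgement Γ = Γ ⊢ps lastVar Γ ∶ lastTy Γ

dim-≤-lastTy : Γ ⊢ps x ∶ A → dim A ≤ dim (lastTy Γ)
dim-≤-lastTy pss     = ≤-refl
dim-≤-lastTy (psd d) = ≤-trans (n≤1+n _) (dim-≤-lastTy d)
dim-≤-lastTy (pse d) = ≤-refl

mutual
  ⊢ps-unique′ : (d : Γ ⊢ps x ∶ A) (e : Δ ⊢ps y ∶ B) → Γ ≡ Δ → dim A ≡ dim B →
                (Σ Ctx Judgement ∋ (Γ , x , A , d)) ≡ (Δ , y , B , e)
  ⊢ps-unique′ pss     pss     _    _ = refl
  ⊢ps-unique′ pss     (pse e) ()   _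
  ⊢ps-unique′ (pse d) pss     ()   _
  ⊢ps-unique′ pss     (psd e) refl h = ⊥-elim (<-irrefl (sym h) (dim-≤-lastTy e))
  ⊢ps-unique′ (psd d) pss     refl h = ⊥-elim (<-irrefl h (dim-≤-lastTy d))
  ⊢ps-unique′ (psd d) (pse e) refl h = ⊥-elim (<-irrefl h (dim-≤-lastTy d))
  ⊢ps-unique′ (pse d) (psd e) refl h = ⊥-elim (<-irrefl (sym h) (dim-≤-lastTy e))
  ⊢ps-unique′ (psd d) (psd e) refl h with ⊢ps-unique d e (cong suc h)
  ... | refl = refl
  ⊢ps-unique′ (pse d) (pse e) p h with ⊢ps-unique′ d e (cong (init ∘ init) p) (suc-injective h)
  ... | refl = refl

  ⊢ps-unique : (d : Γ ⊢ps x ∶ A) (e : Γ ⊢ps y ∶ B) → dim A ≡ dim B →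
               (Judgement Γ ∋ (x , A , d)) ≡ (y , B , e)
  ⊢ps-unique d e h = ,-injectiveʳ-UIP (Decidable⇒UIP.≡-irrelevant _≟ᶜ_) (⊢ps-unique′ d e refl h)

nil-⊬ps : ¬ (nil ⊢ps x ∶ A)
nil-⊬ps (psd d) = nil-⊬ps d

singleton-⊢ps-inv : ∀ {p} → (nil :: p) ⊢ps x ∶ A → nil :: p ≡ nil :: (0 , ⋆)
singleton-⊢ps-inv pss     = refl
singleton-⊢ps-inv (psd d) = singleton-⊢ps-inv d

srcVar : Ty → ℕ
srcVar ⋆               = 0
srcVar (⇒ _ (Var x) _) = x

extend-⊢ps-inv : ∀ {a b} → (Γ :: (a , A) :: (b , B)) ⊢ps x ∶ T →
                 (Γ :: (a , A) :: (b , B) ≡ extend Γ (srcVar B) A) × Γ ⊢ps srcVar B ∶ A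
extend-⊢ps-inv (psd d) = extend-⊢ps-inv d
extend-⊢ps-inv (pse d) = refl , d

⊢ps?-at-dim : Γ ⊢ps y ∶ B → ∀ x A → dim B ≡ dim A → Dec (Γ ⊢ps x ∶ A)
⊢ps?-at-dim {y = y} {B = B} e x A h =
  map′ (λ { (refl , refl) → e })
       (λ d → let eq = ⊢ps-unique e d h in cong proj₁ eq , cong (proj₁ ∘ proj₂) eq)
       (y ≟ℕ x ×-dec B ≟ᵀ A)

⊢ps?-below : ∀ T → Γ ⊢ps t ∶ T → ∀ x A → dim A ≤ dim T → Dec (Γ ⊢ps x ∶ A)
⊢ps?-below T d x A A≤T with dim A ≟ℕ dim T
... | yes eq = ⊢ps?-at-dim d x A (sym eq)
⊢ps?-below ⋆ d x A A≤T | no ne = ⊥-elim (n≮0 (≤∧≢⇒< A≤T ne))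
⊢ps?-below (⇒ T (Var _) (Var _)) d x A A≤T | no ne =
  ⊢ps?-below T (psd d) x A (≤-pred (≤∧≢⇒< A≤T ne))

mutual
  lastJudgement? : ∀ Γ → LastJudgement Γ ⊎ ¬ Judgement Γ
  lastJudgement? nil = inj₂ λ (_ , _ , d) → nil-⊬ps d
  lastJudgement? (nil :: p) with (nil :: p) ≟ᶜ (nil :: (0 , ⋆))
  ... | yes eq = inj₁ (subst LastJudgement (sym eq) pss)
  ... | no ne  = inj₂ λ (_ , _ , d) → ne (singleton-⊢ps-inv d)
  lastJudgement? (Γ :: (a , A) :: (b , B))
    with (Γ :: (a , A) :: (b , B)) ≟ᶜ extend Γ (srcVar B) A | Γ ⊢ps? srcVar B ∶ A
  ... | yes eq | yes d = inj₁ (subst LastJudgement (sym eq) (pse d))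
  ... | no ne  | _     = inj₂ λ (_ , _ , d) → ne (proj₁ (extend-⊢ps-inv d))
  ... | yes _  | no ¬d = inj₂ λ (_ , _ , d) → ¬d (proj₂ (extend-⊢ps-inv d))

  _⊢ps?_∶_ : ∀ Γ x A → Dec (Γ ⊢ps x ∶ A)
  Γ ⊢ps? x ∶ A with lastJudgement? Γ
  ... | inj₂ none = no λ d → none (x , A , d)
  ... | inj₁ last with dim A ≤? dim (lastTy Γ)
  ...   | yes A≤last = ⊢ps?-below (lastTy Γ) last x A A≤last
  ...   | no A≰last  = no (A≰last ∘ dim-≤-lastTy)

⊢ps-down : ∀ A → Γ ⊢ps x ∶ A → Γ ⊢ps
⊢ps-down ⋆                     d = ps _ d
⊢ps-down (⇒ A (Var _) (Var _)) d = ⊢ps-down A (psd d)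

⊢ps-isProp : isProp (Γ ⊢ps)
⊢ps-isProp (ps x d) (ps y e) with ⊢ps-unique d e refl
... | refl = refl

⊢ps-dec : ∀ Γ → (Γ ⊢ps) ⊎ ¬ (Γ ⊢ps)
⊢ps-dec Γ with lastJudgement? Γ
... | inj₁ last = inj₁ (⊢ps-down _ last)
... | inj₂ none = inj₂ λ { (ps x d) → none (x , ⋆ , d) }

mainTheorem16 : (Γ : Ctx) → isProp (Γ ⊢ps) × ((Γ ⊢ps) ⊎ (¬ (Γ ⊢ps)))
mainTheorem16 Γ = ⊢ps-isProp , ⊢ps-dec Γ
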